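{- Let $q$ be a prime power, $n\ge 2$ and $k\ge 1$ integers. Then $\{A\in M_n(\mathbb F_q)\mid A^2=A\}=\{A^k\mid A\in M_n(\mathbb F_q)\}$ if and only if $e_{n,q}$ divides $k$.
   Context: $e_{n,q}$ denotes the exponent of the group $GL_n(\mathbb F_q)$, i.e. the least positive integer $e$ with $g^e=I_n$ for all $g\in GL_n(\mathbb F_q)$ (the paper calls it the exponent of $M_n(\mathbb F_q)$). -}

module Defs where

open import Level using (Level; _⊔_)
open import Data.Nat as ℕ using (ℕ; zero; suc)
open import Data.Nat.Primality using (Prime)
open import Data.Fin using (Fin; zero; suc)
open import Data.Product using (Σ; ∃; _×_; _,_)
open import Relation.Nullary using (¬_)
open import Relation.Binary.PropositionalEquality as ≡ using (_≡_)
open import Function.Bundles using (Bijection)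
open import Algebra.Bundles using (CommutativeRing)

IsPrimePower : ℕ → Set
IsPrimePower q = Σ ℕ λ p → Σ ℕ λ m → Prime p × q ≡ p ℕ.^ suc m

record IsFieldRing {c ℓ : Level} (R : CommutativeRing c ℓ) : Set (c ⊔ ℓ) where
  open CommutativeRing R using (Carrier; _≈_; _+_; _*_; 0#; 1#)
  field
    1≉0     : ¬ (1# ≈ 0#)
    inverse : ∀ x → ¬ (x ≈ 0#) → Σ Carrier λ y → x * y ≈ 1#

record FiniteField (c ℓ : Level) (q : ℕ) : Set (Level.suc (c ⊔ ℓ)) where
  field
    ring     : CommutativeRing c ℓ
    isField  : IsFieldRing ring
    counting : Bijection (≡.setoid (Fin q)) (CommutativeRing.setoid ring)

module Matrices {c ℓ : Level} (R : CommutativeRing c ℓ) where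
  open CommutativeRing R using (Carrier; _≈_; _+_; _*_; 0#; 1#)

  Mat : ℕ → Set c
  Mat n = Fin n → Fin n → Carrier

  _≈ᴹ_ : ∀ {n} → Mat n → Mat n → Set ℓ
  A ≈ᴹ B = ∀ i j → A i j ≈ B i j

  Σᶠ : ∀ n → (Fin n → Carrier) → Carrier
  Σᶠ zero    f = 0#
  Σᶠ (suc n) f = f zero + Σᶠ n (λ i → f (suc i))

  _*ᴹ_ : ∀ {n} → Mat n → Mat n → Mat n
  _*ᴹ_ {n} A B i j = Σᶠ n (λ l → A i l * B l j)

  I : ∀ {n} → Mat n
  I zero    zero    = 1#
  I zero    (suc j) = 0#
  I (suc i) zero    = 0#
  I (suc i) (suc j) = I i j

  _^ᴹ_ : ∀ {n} → Mat n → ℕ → Mat n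
  A ^ᴹ zero  = I
  A ^ᴹ suc k = A *ᴹ (A ^ᴹ k)

  Invertible : ∀ {n} → Mat n → Set (c ⊔ ℓ)
  Invertible {n} A = Σ (Mat n) λ B → (A *ᴹ B) ≈ᴹ I × (B *ᴹ A) ≈ᴹ I

  KillsGL : ℕ → ℕ → Set (c ⊔ ℓ)
  KillsGL n e = ∀ (g : Mat n) → Invertible g → (g ^ᴹ e) ≈ᴹ I

  record IsExponentGL (n e : ℕ) : Set (c ⊔ ℓ) where
    field
      positive : 0 ℕ.< e
      kills    : KillsGL n e
      least    : ∀ d → 0 ℕ.< d → KillsGL n d → e ℕ.≤ d

  -- {A | A² = A} = {A^k | A ∈ M_n}, as mutual inclusion (up to matrix equality)
  IdempotentsAreKthPowers : ℕ → ℕ → Set (c ⊔ ℓ)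
  IdempotentsAreKthPowers n k =
    (∀ (A : Mat n) → (A *ᴹ A) ≈ᴹ A → Σ (Mat n) λ B → (B ^ᴹ k) ≈ᴹ A)
    × (∀ (B : Mat n) → ((B ^ᴹ k) *ᴹ (B ^ᴹ k)) ≈ᴹ (B ^ᴹ k))

-- If every k-th power is idempotent, then for invertible g the idempotent g ^ k is invertible,
-- hence equal to I; so k kills GL_n and the exponent e divides k.  Conversely let e ∣ k, so that
-- g ^ k = I on GL_n.  For arbitrary B, finiteness makes some
-- power E = B ^ m idempotent; with F = I - E, the matrix B E + F is invertible and N = B F is
-- nilpotent, so B ^ k E = E and (I + N) ^ k = I.  Every integer multiple of 1 in a field is 0 or
-- invertible, and C(k, k) = 1, so in the binomial expansion of (I + N) ^ k - I = 0 the first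
-- invertible coefficient exhibits a power N ^ i, i ≤ k, as N times a multiple of itself; hence
-- N ^ k = 0 and B ^ k = B ^ k E + N ^ k = E is idempotent.

module Submission where

open import Defs
open import Level using (Level; _⊔_)
open import Algebra.Bundles using (Ring; CommutativeRing)
open import Data.Nat using (ℕ; zero; suc; _≤_; _<_; NonZero; z≤n; s≤s)
import Data.Nat as ℕ
import Data.Nat.Properties as ℕ
open import Data.Nat.Combinatorics using (_C_; nCn≡1; k>n⇒nCk≡0; nCk+nC[k+1]≡[n+1]C[k+1])
open import Data.Nat.DivMod using (_%_; _/_; m≡m%n+[m/n]*n; m%n<n)
open import Data.Nat.Divisibility using (_∣_; divides; m%n≡0⇒n∣m)
open import Data.Fin using (Fin; toℕ; funToFin)
import Data.Fin as Fin
open import Data.Fin.Properties using (pigeonhole; finToFun-funToFin)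
open import Data.Product using (Σ; ∃; _×_; _,_)
open import Data.Sum using (_⊎_; inj₁; inj₂)
open import Data.Empty using (⊥-elim)
open import Function using (_∘_)
open import Function.Bundles using (Injection; Equivalence; _⇔_; mk⇔)
open import Function.Properties.Bijection using (Bijection⇒Inverse)
open import Function.Properties.Inverse using (Inverse⇒Injection)
import Function.Construct.Symmetry as Symmetry
open import Relation.Nullary using (yes; no)
open import Relation.Nullary.Decidable using (via-injection)
open import Relation.Binary.PropositionalEquality as ≡ using (_≡_)

module ExponentOfUnits {c ℓ : Level} (R : Ring c ℓ) where
  open Ring R hiding (zero)
  open import Algebra.Properties.Ring R
  open import Algebra.Properties.Semiring.Exp semiring
  import Algebra.Properties.Semiring.Mult semiring as Mult
  import Algebra.Properties.Monoid.Mult *-monoid as Exp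
  open import Relation.Binary.Reasoning.Setoid setoid

  IsUnit : Carrier → Set (c ⊔ ℓ)
  IsUnit g = Σ Carrier λ h → g * h ≈ 1# × h * g ≈ 1#

  IsIdempotent : Carrier → Set ℓ
  IsIdempotent x = x * x ≈ x

  KillsUnits : ℕ → Set (c ⊔ ℓ)
  KillsUnits e = ∀ g → IsUnit g → g ^ e ≈ 1#

  ι : ℕ → Carrier
  ι a = a Mult.× 1#

  RightInvertible : Carrier → Set (c ⊔ ℓ)
  RightInvertible x = ∃ λ u → x * u ≈ 1#

  NatImageZeroOrInvertible : Set (c ⊔ ℓ)
  NatImageZeroOrInvertible = ∀ a → ι a ≈ 0# ⊎ RightInvertible (ι a)

  ^-sucʳ : ∀ x j → x ^ suc j ≈ x ^ j * x
  ^-sucʳ x j = begin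
    x ^ suc j         ≡⟨ ≡.cong (x ^_) (ℕ.+-comm 1 j) ⟩
    x ^ (j ℕ.+ 1)     ≈⟨ ^-homo-* x j 1 ⟩
    x ^ j * (x * 1#)  ≈⟨ *-congˡ (*-identityʳ x) ⟩
    x ^ j * x         ∎

  ^-commutes : ∀ {x y} → x * y ≈ y * x → ∀ j → x ^ j * y ≈ y * x ^ j
  ^-commutes {x} {y} xy≈yx zero = trans (*-identityˡ y) (sym (*-identityʳ y))
  ^-commutes {x} {y} xy≈yx (suc j) = begin
    (x * x ^ j) * y  ≈⟨ *-assoc x _ y ⟩
    x * (x ^ j * y)  ≈⟨ *-congˡ (^-commutes xy≈yx j) ⟩
    x * (y * x ^ j)  ≈⟨ *-assoc x y _ ⟨
    (x * y) * x ^ j  ≈⟨ *-congʳ xy≈yx ⟩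
    (y * x) * x ^ j  ≈⟨ *-assoc y x _ ⟩
    y * (x * x ^ j)  ∎

  ^-comm : ∀ x i j → x ^ i * x ^ j ≈ x ^ j * x ^ i
  ^-comm x i j = ^-commutes (sym (^-commutes refl j)) i

  ^-distrib-* : ∀ {x y} → x * y ≈ y * x → ∀ j → (x * y) ^ j ≈ x ^ j * y ^ j
  ^-distrib-* {x} {y} xy≈yx zero = sym (*-identityˡ 1#)
  ^-distrib-* {x} {y} xy≈yx (suc j) = begin
    (x * y) * (x * y) ^ j      ≈⟨ *-congˡ (^-distrib-* xy≈yx j) ⟩
    (x * y) * (x ^ j * y ^ j)  ≈⟨ *-assoc x y _ ⟩
    x * (y * (x ^ j * y ^ j))  ≈⟨ *-congˡ (y*x^m*y^n≈x^m*y^[n+1] xy≈yx j j) ⟩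
    x * (x ^ j * y ^ suc j)    ≈⟨ *-assoc x _ _ ⟨
    x ^ suc j * y ^ suc j      ∎

  1#^ : ∀ d → 1# ^ d ≈ 1#
  1#^ zero    = refl
  1#^ (suc d) = trans (*-identityˡ _) (1#^ d)

  -‿nilpotent : ∀ {x} m → x ^ m ≈ 0# → (- x) ^ m ≈ 0#
  -‿nilpotent {x} m xᵐ≈0 = begin
    (- x) ^ m            ≈⟨ ^-congˡ m (-1*x≈-x x) ⟨
    (- 1# * x) ^ m       ≈⟨ ^-distrib-* -1x≈x-1 m ⟩
    (- 1#) ^ m * x ^ m   ≈⟨ *-congˡ xᵐ≈0 ⟩
    (- 1#) ^ m * 0#      ≈⟨ zeroʳ _ ⟩
    0#                   ∎
    where
    -1x≈x-1 : - 1# * x ≈ x * - 1#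
    -1x≈x-1 = trans (-1*x≈-x x) (trans (-‿cong (sym (*-identityʳ x))) (-‿distribʳ-* x 1#))

  idempotent-^ : ∀ {a} → IsIdempotent a → ∀ k → a ^ suc k ≈ a
  idempotent-^ aa≈a k = Exp.×-idem aa≈a (suc k)

  ^-rightInverse : ∀ {g h} → g * h ≈ 1# → ∀ j → g ^ j * h ^ j ≈ 1#
  ^-rightInverse {g} {h} gh≈1 zero = *-identityˡ 1#
  ^-rightInverse {g} {h} gh≈1 (suc j) = begin
    (g * g ^ j) * h ^ suc j    ≈⟨ *-congˡ (^-sucʳ h j) ⟩
    (g * g ^ j) * (h ^ j * h)  ≈⟨ *-assoc g _ _ ⟩
    g * (g ^ j * (h ^ j * h))  ≈⟨ *-congˡ (*-assoc _ _ h) ⟨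
    g * ((g ^ j * h ^ j) * h)  ≈⟨ *-congˡ (*-congʳ (^-rightInverse gh≈1 j)) ⟩
    g * (1# * h)               ≈⟨ *-congˡ (*-identityˡ h) ⟩
    g * h                      ≈⟨ gh≈1 ⟩
    1#                         ∎

  idempotent-rightInvertible⇒≈1 : ∀ {p q} → IsIdempotent p → p * q ≈ 1# → p ≈ 1#
  idempotent-rightInvertible⇒≈1 {p} {q} pp≈p pq≈1 = begin
    p             ≈⟨ *-identityʳ p ⟨
    p * 1#        ≈⟨ *-congˡ pq≈1 ⟨
    p * (p * q)   ≈⟨ *-assoc p p q ⟨
    (p * p) * q   ≈⟨ *-congʳ pp≈p ⟩
    p * q         ≈⟨ pq≈1 ⟩
    1#            ∎

  idempotentPowers⇒killsUnits : ∀ k → (∀ x → IsIdempotent (x ^ k)) → KillsUnits k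
  idempotentPowers⇒killsUnits k powersIdempotent g (h , gh≈1 , _) =
    idempotent-rightInvertible⇒≈1 (powersIdempotent g) (^-rightInverse gh≈1 k)

  killsUnits-* : ∀ {e} → KillsUnits e → ∀ d → KillsUnits (d ℕ.* e)
  killsUnits-* {e} kills d g g-unit = begin
    g ^ (d ℕ.* e)   ≡⟨ ≡.cong (g ^_) (ℕ.*-comm d e) ⟩
    g ^ (e ℕ.* d)   ≈⟨ ^-assocʳ g e d ⟨
    (g ^ e) ^ d     ≈⟨ ^-congˡ d (kills g g-unit) ⟩
    1# ^ d          ≈⟨ 1#^ d ⟩
    1#              ∎

  killsUnits-% : ∀ {e k} .{{_ : NonZero e}} → KillsUnits e → KillsUnits k → KillsUnits (k % e)
  killsUnits-% {e} {k} killsₑ killsₖ g g-unit = begin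
    g ^ (k % e)                        ≈⟨ *-identityʳ _ ⟨
    g ^ (k % e) * 1#                   ≈⟨ *-congˡ (killsUnits-* killsₑ (k / e) g g-unit) ⟨
    g ^ (k % e) * g ^ (k / e ℕ.* e)    ≈⟨ ^-homo-* g (k % e) _ ⟨
    g ^ (k % e ℕ.+ k / e ℕ.* e)        ≡⟨ ≡.cong (g ^_) (m≡m%n+[m/n]*n k e) ⟨
    g ^ k                              ≈⟨ killsₖ g g-unit ⟩
    1#                                 ∎

  leastKiller-∣ : ∀ {e k} .{{_ : NonZero e}} → (∀ d → 0 < d → KillsUnits d → e ≤ d) →
                  KillsUnits e → KillsUnits k → e ∣ k
  leastKiller-∣ {e} {k} least killsₑ killsₖ with k % e in k%e≡r
  ... | zero  = m%n≡0⇒n∣m k e k%e≡r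
  ... | suc r = ⊥-elim (ℕ.<⇒≱ r<e (least (suc r) (s≤s z≤n) killsᵣ))
    where
    r<e : suc r < e
    r<e = ≡.subst (_< e) k%e≡r (m%n<n k e)
    killsᵣ : KillsUnits (suc r)
    killsᵣ = ≡.subst KillsUnits k%e≡r (killsUnits-% killsₑ killsₖ)

  geometric : Carrier → ℕ → Carrier
  geometric y zero    = 0#
  geometric y (suc j) = 1# + y * geometric y j

  private
    geometric-step : ∀ y j → (1# - y) + y * (1# - y ^ j) ≈ 1# - y ^ suc j
    geometric-step y j = begin
      (1# - y) + y * (1# - y ^ j)      ≈⟨ +-congˡ (x[y-z]≈xy-xz y 1# (y ^ j)) ⟩
      (1# - y) + (y * 1# - y ^ suc j)  ≈⟨ +-congˡ (+-congʳ (*-identityʳ y)) ⟩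
      (1# - y) + (y - y ^ suc j)       ≈⟨ +-assoc 1# (- y) _ ⟩
      1# + (- y + (y - y ^ suc j))     ≈⟨ +-congˡ (+-assoc (- y) y _) ⟨
      1# + ((- y + y) - y ^ suc j)     ≈⟨ +-congˡ (+-congʳ (-‿inverseˡ y)) ⟩
      1# + (0# - y ^ suc j)            ≈⟨ +-congˡ (+-identityˡ _) ⟩
      1# - y ^ suc j                   ∎

  [1-y]*geometric : ∀ y j → (1# - y) * geometric y j ≈ 1# - y ^ j
  [1-y]*geometric y zero    = trans (zeroʳ _) (sym (-‿inverseʳ 1#))
  [1-y]*geometric y (suc j) = begin
    (1# - y) * (1# + y * G)                   ≈⟨ distribˡ _ 1# _ ⟩
    (1# - y) * 1# + (1# - y) * (y * G)        ≈⟨ +-cong (*-identityʳ _) (sym (*-assoc _ y G)) ⟩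
    (1# - y) + ((1# - y) * y) * G             ≈⟨ +-congˡ (*-congʳ 1-y-commutes) ⟩
    (1# - y) + (y * (1# - y)) * G             ≈⟨ +-congˡ (*-assoc y _ G) ⟩
    (1# - y) + y * ((1# - y) * G)             ≈⟨ +-congˡ (*-congˡ ([1-y]*geometric y j)) ⟩
    (1# - y) + y * (1# - y ^ j)               ≈⟨ geometric-step y j ⟩
    1# - y ^ suc j                            ∎
    where
    G = geometric y j
    1-y-commutes : (1# - y) * y ≈ y * (1# - y)
    1-y-commutes = begin
      (1# - y) * y      ≈⟨ [y-z]x≈yx-zx y 1# y ⟩
      1# * y - y * y    ≈⟨ +-congʳ (trans (*-identityˡ y) (sym (*-identityʳ y))) ⟩
      y * 1# - y * y    ≈⟨ x[y-z]≈xy-xz y 1# y ⟨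
      y * (1# - y)      ∎

  geometric*[1-y] : ∀ y j → geometric y j * (1# - y) ≈ 1# - y ^ j
  geometric*[1-y] y zero    = trans (zeroˡ _) (sym (-‿inverseʳ 1#))
  geometric*[1-y] y (suc j) = begin
    (1# + y * G) * (1# - y)                   ≈⟨ distribʳ _ 1# _ ⟩
    1# * (1# - y) + (y * G) * (1# - y)        ≈⟨ +-cong (*-identityˡ _) (*-assoc y G _) ⟩
    (1# - y) + y * (G * (1# - y))             ≈⟨ +-congˡ (*-congˡ (geometric*[1-y] y j)) ⟩
    (1# - y) + y * (1# - y ^ j)               ≈⟨ geometric-step y j ⟩
    1# - y ^ suc j                            ∎
    where G = geometric y j

  1+nilpotent-isUnit : ∀ {x} m → x ^ m ≈ 0# → IsUnit (1# + x)
  1+nilpotent-isUnit {x} m xᵐ≈0 =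
    geometric (- x) m ,
    trans (*-congʳ 1+x≈1-[-x]) (trans ([1-y]*geometric (- x) m) 1-[-x]ᵐ≈1) ,
    trans (*-congˡ 1+x≈1-[-x]) (trans (geometric*[1-y] (- x) m) 1-[-x]ᵐ≈1)
    where
    1+x≈1-[-x] : 1# + x ≈ 1# - - x
    1+x≈1-[-x] = +-congˡ (sym (-‿involutive x))
    1-[-x]ᵐ≈1 : 1# - (- x) ^ m ≈ 1#
    1-[-x]ᵐ≈1 = trans (+-congˡ (trans (-‿cong (-‿nilpotent m xᵐ≈0)) -0#≈0#)) (+-identityʳ 1#)

  ^≈0⇒^+≈0 : ∀ {x} p j → x ^ p ≈ 0# → x ^ (p ℕ.+ j) ≈ 0#
  ^≈0⇒^+≈0 {x} p j xᵖ≈0 = begin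
    x ^ (p ℕ.+ j)   ≈⟨ ^-homo-* x p j ⟩
    x ^ p * x ^ j   ≈⟨ *-congʳ xᵖ≈0 ⟩
    0# * x ^ j      ≈⟨ zeroˡ _ ⟩
    0#              ∎

  x≈n*[x*v]⇒x≈0 : ∀ {n x v} m → n ^ m ≈ 0# → x ≈ n * (x * v) → x ≈ 0#
  x≈n*[x*v]⇒x≈0 {n} {x} {v} m nᵐ≈0 x≈nxv = begin
    x                    ≈⟨ iterate m ⟩
    n ^ m * (x * v ^ m)  ≈⟨ *-congʳ nᵐ≈0 ⟩
    0# * (x * v ^ m)     ≈⟨ zeroˡ _ ⟩
    0#                   ∎
    where
    iterate : ∀ j → x ≈ n ^ j * (x * v ^ j)
    iterate zero    = sym (trans (*-identityˡ _) (*-identityʳ x))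
    iterate (suc j) = begin
      x                                 ≈⟨ iterate j ⟩
      n ^ j * (x * v ^ j)               ≈⟨ *-congˡ (*-congʳ x≈nxv) ⟩
      n ^ j * ((n * (x * v)) * v ^ j)   ≈⟨ *-congˡ (*-assoc n _ _) ⟩
      n ^ j * (n * ((x * v) * v ^ j))   ≈⟨ *-assoc _ n _ ⟨
      (n ^ j * n) * ((x * v) * v ^ j)   ≈⟨ *-cong (sym (^-sucʳ n j)) (*-assoc x v _) ⟩
      n ^ suc j * (x * (v * v ^ j))     ∎

  module Horner (N : Carrier) where

    horner : (ℕ → Carrier) → ℕ → Carrier
    horner a zero    = 0#
    horner a (suc l) = a 0 + N * horner (a ∘ suc) l

    horner-cong : ∀ {a b} → (∀ i → a i ≈ b i) → ∀ l → horner a l ≈ horner b l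
    horner-cong a≈b zero    = refl
    horner-cong a≈b (suc l) = +-cong (a≈b 0) (*-congˡ (horner-cong (a≈b ∘ suc) l))

    pascal : (ℕ → Carrier) → ℕ → Carrier
    pascal a zero    = a zero
    pascal a (suc i) = a (suc i) + a i

    [1+N]*horner : ∀ l a → a l ≈ 0# → (1# + N) * horner a l ≈ horner (pascal a) (suc l)
    [1+N]*horner zero a a₀≈0 = begin
      (1# + N) * 0#  ≈⟨ zeroʳ _ ⟩
      0#             ≈⟨ +-identityʳ 0# ⟨
      0# + 0#        ≈⟨ +-cong a₀≈0 (zeroʳ N) ⟨
      a 0 + N * 0#   ∎
    [1+N]*horner (suc l) a aₗ≈0 = begin
      (1# + N) * (a₀ + N * H)                    ≈⟨ distribˡ _ a₀ _ ⟩
      (1# + N) * a₀ + (1# + N) * (N * H)         ≈⟨ +-cong (distribʳ a₀ 1# N) (sym (*-assoc _ N H)) ⟩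
      (1# * a₀ + N * a₀) + ((1# + N) * N) * H    ≈⟨ +-cong (+-congʳ (*-identityˡ a₀)) (*-congʳ N-commutes) ⟩
      (a₀ + N * a₀) + (N * (1# + N)) * H         ≈⟨ +-congˡ (*-assoc N _ H) ⟩
      (a₀ + N * a₀) + N * ((1# + N) * H)         ≈⟨ +-congˡ (*-congˡ ([1+N]*horner l (a ∘ suc) aₗ≈0)) ⟩
      (a₀ + N * a₀) + N * (a 1 + W)              ≈⟨ +-assoc a₀ _ _ ⟩
      a₀ + (N * a₀ + N * (a 1 + W))              ≈⟨ +-congˡ (distribˡ N a₀ _) ⟨
      a₀ + N * (a₀ + (a 1 + W))                  ≈⟨ +-congˡ (*-congˡ (+-assoc a₀ _ W)) ⟨
      a₀ + N * ((a₀ + a 1) + W)                  ≈⟨ +-congˡ (*-congˡ (+-congʳ (+-comm a₀ _))) ⟩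
      a₀ + N * ((a 1 + a₀) + W)                  ∎
      where
      a₀ = a 0
      H = horner (a ∘ suc) l
      W = N * horner (pascal a ∘ suc ∘ suc) l
      N-commutes : (1# + N) * N ≈ N * (1# + N)
      N-commutes = begin
        (1# + N) * N      ≈⟨ distribʳ N 1# N ⟩
        1# * N + N * N    ≈⟨ +-congʳ (trans (*-identityˡ N) (sym (*-identityʳ N))) ⟩
        N * 1# + N * N    ≈⟨ distribˡ N 1# N ⟨
        N * (1# + N)      ∎

    binomial : ∀ k → (1# + N) ^ k ≈ horner (ι ∘ (k C_)) (suc k)
    binomial zero = begin
      1#               ≈⟨ Mult.×-homo-1 1# ⟨
      ι 1              ≈⟨ +-identityʳ _ ⟨
      ι 1 + 0#         ≈⟨ +-congˡ (zeroʳ N) ⟨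
      ι 1 + N * 0#     ∎
    binomial (suc k) = begin
      (1# + N) * (1# + N) ^ k                       ≈⟨ *-congˡ (binomial k) ⟩
      (1# + N) * horner (ι ∘ (k C_)) (suc k)        ≈⟨ [1+N]*horner (suc k) (ι ∘ (k C_)) top≈0 ⟩
      horner (pascal (ι ∘ (k C_))) (suc (suc k))    ≈⟨ horner-cong pascal-rule (suc (suc k)) ⟩
      horner (ι ∘ (suc k C_)) (suc (suc k))         ∎
      where
      top≈0 : ι (k C suc k) ≈ 0#
      top≈0 = reflexive (≡.cong ι (k>n⇒nCk≡0 (ℕ.n<1+n k)))
      pascal-rule : ∀ i → pascal (ι ∘ (k C_)) i ≈ ι (suc k C i)
      pascal-rule zero    = refl
      pascal-rule (suc i) = begin
        ι (k C suc i) + ι (k C i)       ≈⟨ +-comm _ _ ⟩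
        ι (k C i) + ι (k C suc i)       ≈⟨ Mult.×-homo-+ 1# (k C i) _ ⟨
        ι (k C i ℕ.+ k C suc i)         ≡⟨ ≡.cong ι (nCk+nC[k+1]≡[n+1]C[k+1] k i) ⟩
        ι (suc k C suc i)               ∎

    module _ {m} (Nᵐ≈0 : N ^ m ≈ 0#) where

      -- N ^ p * (a 0 + N * H) ≈ 0 with a 0 invertible exhibits N ^ p as N times a multiple of itself.
      invertibleHead⇒^≈0 : ∀ a l p → RightInvertible (a 0) →
                                   N ^ p * horner a (suc l) ≈ 0# → N ^ p ≈ 0#
      invertibleHead⇒^≈0 a l p (v , a₀v≈1) NᵖH≈0 = x≈n*[x*v]⇒x≈0 m Nᵐ≈0 (begin
        X                              ≈⟨ *-identityʳ X ⟨
        X * 1#                         ≈⟨ *-congˡ a₀v≈1 ⟨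
        X * (a 0 * v)                  ≈⟨ *-assoc X _ v ⟨
        (X * a 0) * v                  ≈⟨ *-congʳ Xa₀≈-XNH ⟩
        - (X * (N * H)) * v            ≈⟨ -‿distribˡ-* _ v ⟨
        - ((X * (N * H)) * v)          ≈⟨ -‿cong (*-congʳ (*-assoc X N H)) ⟨
        - (((X * N) * H) * v)          ≈⟨ -‿cong (*-assoc _ H v) ⟩
        - ((X * N) * (H * v))          ≈⟨ -‿distribʳ-* _ _ ⟩
        (X * N) * - (H * v)            ≈⟨ *-congʳ (^-commutes refl p) ⟩
        (N * X) * - (H * v)            ≈⟨ *-assoc N X _ ⟩
        N * (X * - (H * v))            ∎)
        where
        X = N ^ p
        H = horner (a ∘ suc) l
        Xa₀≈-XNH : X * a 0 ≈ - (X * (N * H))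
        Xa₀≈-XNH = +-inverseˡ-unique _ _ (trans (sym (distribˡ X (a 0) _)) NᵖH≈0)

      invertibleCoefficient⇒^≈0 :
        ∀ a → (∀ j → a j ≈ 0# ⊎ RightInvertible (a j)) →
        ∀ l p {i} → i < l → RightInvertible (a i) → N ^ p * horner a l ≈ 0# → N ^ (p ℕ.+ i) ≈ 0#
      invertibleCoefficient⇒^≈0 a dichotomy (suc l) p {zero} _ a₀-inv NᵖH≈0 =
        ^≈0⇒^+≈0 p 0 (invertibleHead⇒^≈0 a l p a₀-inv NᵖH≈0)
      invertibleCoefficient⇒^≈0 a dichotomy (suc l) p {suc i} (s≤s i<l) aᵢ-inv NᵖH≈0
        with dichotomy 0
      ... | inj₂ a₀-inv = ^≈0⇒^+≈0 p (suc i) (invertibleHead⇒^≈0 a l p a₀-inv NᵖH≈0)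
      ... | inj₁ a₀≈0   = begin
        N ^ (p ℕ.+ suc i)   ≡⟨ ≡.cong (N ^_) (ℕ.+-suc p i) ⟩
        N ^ (suc p ℕ.+ i)   ≈⟨ invertibleCoefficient⇒^≈0 (a ∘ suc) (dichotomy ∘ suc) l (suc p) i<l aᵢ-inv Nᵖ⁺¹H≈0 ⟩
        0#                  ∎
        where
        H = horner (a ∘ suc) l
        Nᵖ⁺¹H≈0 : N ^ suc p * H ≈ 0#
        Nᵖ⁺¹H≈0 = begin
          N ^ suc p * H          ≈⟨ *-congʳ (^-sucʳ N p) ⟩
          (N ^ p * N) * H        ≈⟨ *-assoc _ N H ⟩
          N ^ p * (N * H)        ≈⟨ *-congˡ (+-identityˡ _) ⟨
          N ^ p * (0# + N * H)   ≈⟨ *-congˡ (+-congʳ a₀≈0) ⟨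
          N ^ p * horner a (suc l) ≈⟨ NᵖH≈0 ⟩
          0#                     ∎

  unipotent-order : NatImageZeroOrInvertible → ∀ {N} m → N ^ m ≈ 0# →
                    ∀ k → (1# + N) ^ suc k ≈ 1# → N ^ suc k ≈ 0#
  unipotent-order dichotomy {N} m Nᵐ≈0 k [1+N]ᴷ≈1 =
    invertibleCoefficient⇒^≈0 {m} Nᵐ≈0 (ι ∘ coefficient) (dichotomy ∘ coefficient)
      K 1 (ℕ.n<1+n k) (1# , top≈1) N¹H≈0
    where
    open Horner N
    K = suc k
    coefficient : ℕ → ℕ
    coefficient i = K C suc i
    H = horner (ι ∘ coefficient) K
    NH≈0 : N * H ≈ 0#
    NH≈0 = +-cancelˡ 1# _ _ (begin
      1# + N * H    ≈⟨ +-congʳ (Mult.×-homo-1 1#) ⟨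
      ι 1 + N * H   ≈⟨ binomial K ⟨
      (1# + N) ^ K  ≈⟨ [1+N]ᴷ≈1 ⟩
      1#            ≈⟨ +-identityʳ 1# ⟨
      1# + 0#       ∎)
    N¹H≈0 : N ^ 1 * H ≈ 0#
    N¹H≈0 = trans (*-congʳ (*-identityʳ N)) NH≈0
    top≈1 : ι (coefficient k) * 1# ≈ 1#
    top≈1 = trans (*-identityʳ _) (trans (reflexive (≡.cong ι (nCn≡1 K))) (Mult.×-homo-1 1#))

  x+[1-x]≈1 : ∀ x → x + (1# - x) ≈ 1#
  x+[1-x]≈1 x = begin
    x + (1# - x)     ≈⟨ +-comm x _ ⟩
    (1# - x) + x     ≈⟨ +-assoc 1# (- x) x ⟩
    1# + (- x + x)   ≈⟨ +-congˡ (-‿inverseˡ x) ⟩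
    1# + 0#          ≈⟨ +-identityʳ 1# ⟩
    1#               ∎

  commutes⇒commutes-1- : ∀ {x y} → x * y ≈ y * x → x * (1# - y) ≈ (1# - y) * x
  commutes⇒commutes-1- {x} {y} xy≈yx = begin
    x * (1# - y)        ≈⟨ x[y-z]≈xy-xz x 1# y ⟩
    x * 1# - x * y      ≈⟨ +-cong (trans (*-identityʳ x) (sym (*-identityˡ x))) (-‿cong xy≈yx) ⟩
    1# * x - y * x      ≈⟨ [y-z]x≈yx-zx x 1# y ⟨
    (1# - y) * x        ∎

  module _ {e} (eᵢ : IsIdempotent e) where

    e*[1-e]≈0 : e * (1# - e) ≈ 0#
    e*[1-e]≈0 = trans (x[y-z]≈xy-xz e 1# e) (trans (+-cong (*-identityʳ e) (-‿cong eᵢ)) (-‿inverseʳ e))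

    [1-e]*e≈0 : (1# - e) * e ≈ 0#
    [1-e]*e≈0 = trans ([y-z]x≈yx-zx e 1# e) (trans (+-cong (*-identityˡ e) (-‿cong eᵢ)) (-‿inverseʳ e))

    [1-e]-idempotent : IsIdempotent (1# - e)
    [1-e]-idempotent = begin
      (1# - e) * (1# - e)            ≈⟨ [y-z]x≈yx-zx (1# - e) 1# e ⟩
      1# * (1# - e) - e * (1# - e)   ≈⟨ +-cong (*-identityˡ _) (-‿cong e*[1-e]≈0) ⟩
      (1# - e) - 0#                  ≈⟨ +-congˡ -0#≈0# ⟩
      (1# - e) + 0#                  ≈⟨ +-identityʳ _ ⟩
      1# - e                         ∎

    [x*e]*[y*e]≈[x*y]*e : ∀ x {y} → y * e ≈ e * y → (x * e) * (y * e) ≈ (x * y) * e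
    [x*e]*[y*e]≈[x*y]*e x {y} ye≈ey = begin
      (x * e) * (y * e)   ≈⟨ *-assoc x e _ ⟩
      x * (e * (y * e))   ≈⟨ *-congˡ (*-congˡ ye≈ey) ⟩
      x * (e * (e * y))   ≈⟨ *-congˡ (*-assoc e e y) ⟨
      x * ((e * e) * y)   ≈⟨ *-congˡ (*-congʳ eᵢ) ⟩
      x * (e * y)         ≈⟨ *-congˡ ye≈ey ⟨
      x * (y * e)         ≈⟨ *-assoc x y e ⟨
      (x * y) * e         ∎

  -- The Fitting decomposition: b is invertible on the range of e and nilpotent on that of f.
  module IdempotentPower (b : Carrier) (m : ℕ) (eᵢ : IsIdempotent (b ^ suc m)) where

    e f : Carrier
    e = b ^ suc m
    f = 1# - e

    ^-commutes-e : ∀ j → b ^ j * e ≈ e * b ^ j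
    ^-commutes-e j = ^-comm b j (suc m)

    block-* : ∀ x {y} → y * e ≈ e * y → (x * e + f) * (y * e + f) ≈ (x * y) * e + f
    block-* x {y} ye≈ey = begin
      (x * e + f) * (y * e + f)                                 ≈⟨ distribʳ _ _ _ ⟩
      (x * e) * (y * e + f) + f * (y * e + f)                   ≈⟨ +-cong (distribˡ _ _ _) (distribˡ _ _ _) ⟩
      ((x * e) * (y * e) + (x * e) * f) + (f * (y * e) + f * f)
        ≈⟨ +-cong (+-cong ([x*e]*[y*e]≈[x*y]*e eᵢ x ye≈ey) xef≈0) (+-cong fye≈0 ([1-e]-idempotent eᵢ)) ⟩
      ((x * y) * e + 0#) + (0# + f)                             ≈⟨ +-cong (+-identityʳ _) (+-identityˡ f) ⟩
      (x * y) * e + f                                           ∎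
      where
      xef≈0 : (x * e) * f ≈ 0#
      xef≈0 = trans (*-assoc x e f) (trans (*-congˡ (e*[1-e]≈0 eᵢ)) (zeroʳ x))
      fye≈0 : f * (y * e) ≈ 0#
      fye≈0 = trans (*-congˡ ye≈ey) (trans (sym (*-assoc f e y)) (trans (*-congʳ ([1-e]*e≈0 eᵢ)) (zeroˡ y)))

    g : Carrier
    g = b * e + f

    g^ : ∀ j → g ^ j ≈ b ^ j * e + f
    g^ zero    = trans (sym (x+[1-x]≈1 e)) (+-congʳ (sym (*-identityˡ e)))
    g^ (suc j) = trans (*-congˡ (g^ j)) (block-* b (^-commutes-e j))

    g-isUnit : IsUnit g
    g-isUnit = b ^ m * e + f , g*h≈1 , h*g≈1
      where
      e+f≈1 : e * e + f ≈ 1#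
      e+f≈1 = trans (+-congʳ eᵢ) (x+[1-x]≈1 e)
      g*h≈1 = trans (block-* b (^-commutes-e m)) e+f≈1
      h*g≈1 = trans (block-* (b ^ m) (sym (^-commutes refl (suc m))))
                    (trans (+-congʳ (*-congʳ (sym (^-sucʳ b m)))) e+f≈1)

    killsUnits⇒^*e≈e : ∀ k → KillsUnits k → b ^ k * e ≈ e
    killsUnits⇒^*e≈e k kills =
      +-cancelʳ f _ _ (trans (sym (g^ k)) (trans (kills g g-isUnit) (sym (x+[1-x]≈1 e))))

    n : Carrier
    n = b * f

    n^ : ∀ j → n ^ suc j ≈ b ^ suc j * f
    n^ zero    = trans (*-identityʳ n) (*-congʳ (sym (*-identityʳ b)))
    n^ (suc j) = trans (*-congˡ (n^ j))
      ([x*e]*[y*e]≈[x*y]*e ([1-e]-idempotent eᵢ) b (commutes⇒commutes-1- (^-commutes-e (suc j))))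

    n-nilpotent : n ^ suc m ≈ 0#
    n-nilpotent = trans (n^ m) (e*[1-e]≈0 eᵢ)

    killsUnits⇒^≈e : NatImageZeroOrInvertible → ∀ k → KillsUnits (suc k) → b ^ suc k ≈ e
    killsUnits⇒^≈e dichotomy k kills = begin
      b ^ K                      ≈⟨ *-identityʳ _ ⟨
      b ^ K * 1#                 ≈⟨ *-congˡ (x+[1-x]≈1 e) ⟨
      b ^ K * (e + f)            ≈⟨ distribˡ _ e f ⟩
      b ^ K * e + b ^ K * f      ≈⟨ +-cong (killsUnits⇒^*e≈e K kills) (sym (n^ k)) ⟩
      e + n ^ K                  ≈⟨ +-congˡ nᴷ≈0 ⟩
      e + 0#                     ≈⟨ +-identityʳ e ⟩
      e                          ∎
      where
      K = suc k
      nᴷ≈0 : n ^ K ≈ 0#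
      nᴷ≈0 = unipotent-order dichotomy (suc m) n-nilpotent k
               (kills (1# + n) (1+nilpotent-isUnit (suc m) n-nilpotent))

  killsUnits⇒idempotentPowers : NatImageZeroOrInvertible → ∀ k → KillsUnits (suc k) →
                                ∀ b m → IsIdempotent (b ^ suc m) → IsIdempotent (b ^ suc k)
  killsUnits⇒idempotentPowers dichotomy k kills b m eᵢ =
    trans (*-cong bᴷ≈e bᴷ≈e) (trans eᵢ (sym bᴷ≈e))
    where
    open IdempotentPower b m eᵢ
    bᴷ≈e = killsUnits⇒^≈e dichotomy k kills

  periodic⇒idempotentPower : ∀ x i p → x ^ i ≈ x ^ (i ℕ.+ suc p) → ∃ λ m → IsIdempotent (x ^ suc m)
  periodic⇒idempotentPower x i p xⁱ≈xⁱ⁺ᴾ = m , (begin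
    x ^ suc m * x ^ suc m        ≈⟨ ^-homo-* x (suc m) (suc m) ⟨
    x ^ (suc m ℕ.+ suc i ℕ.* P)  ≈⟨ shifts (suc i) (suc m) i≤m ⟩
    x ^ suc m                    ∎)
    where
    P m : ℕ
    P = suc p
    -- suc m is definitionally suc i * P: a multiple of the period that is at least i.
    m = p ℕ.+ i ℕ.* P
    i≤m : i ≤ suc m
    i≤m = ℕ.≤-trans (ℕ.m≤m*n i P) (ℕ.m≤n+m (i ℕ.* P) P)
    shift : ∀ y → i ≤ y → x ^ (y ℕ.+ P) ≈ x ^ y
    shift y i≤y = begin
      x ^ (y ℕ.+ P)                  ≡⟨ ≡.cong (λ z → x ^ (z ℕ.+ P)) (ℕ.m∸n+n≡m i≤y) ⟨
      x ^ ((y ℕ.∸ i) ℕ.+ i ℕ.+ P)    ≡⟨ ≡.cong (x ^_) (ℕ.+-assoc (y ℕ.∸ i) i P) ⟩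
      x ^ ((y ℕ.∸ i) ℕ.+ (i ℕ.+ P))  ≈⟨ ^-homo-* x (y ℕ.∸ i) _ ⟩
      x ^ (y ℕ.∸ i) * x ^ (i ℕ.+ P)  ≈⟨ *-congˡ xⁱ≈xⁱ⁺ᴾ ⟨
      x ^ (y ℕ.∸ i) * x ^ i          ≈⟨ ^-homo-* x (y ℕ.∸ i) i ⟨
      x ^ ((y ℕ.∸ i) ℕ.+ i)          ≡⟨ ≡.cong (x ^_) (ℕ.m∸n+n≡m i≤y) ⟩
      x ^ y                          ∎
    shifts : ∀ s y → i ≤ y → x ^ (y ℕ.+ s ℕ.* P) ≈ x ^ y
    shifts zero    y i≤y = ^-congʳ x (ℕ.+-identityʳ y)
    shifts (suc s) y i≤y = begin
      x ^ (y ℕ.+ (P ℕ.+ s ℕ.* P))   ≡⟨ ≡.cong (x ^_) (≡.trans (≡.cong (y ℕ.+_) (ℕ.+-comm P _)) (≡.sym (ℕ.+-assoc y _ P))) ⟩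
      x ^ ((y ℕ.+ s ℕ.* P) ℕ.+ P)   ≈⟨ shift _ (ℕ.≤-trans i≤y (ℕ.m≤m+n y _)) ⟩
      x ^ (y ℕ.+ s ℕ.* P)           ≈⟨ shifts s y i≤y ⟩
      x ^ y                         ∎

  finite⇒idempotentPower : ∀ {Q} (code : Carrier → Fin Q) → (∀ {x y} → code x ≡ code y → x ≈ y) →
                           ∀ x → ∃ λ m → IsIdempotent (x ^ suc m)
  finite⇒idempotentPower {Q} code code-injective x
    with i , j , i<j , codeᵢ≡codeⱼ ← pigeonhole (ℕ.n<1+n Q) (code ∘ (x ^_) ∘ toℕ)
    with p , i+1+p≡j ← ℕ.m≤n⇒∃[o]m+o≡n i<j
    = periodic⇒idempotentPower x (toℕ i) p (begin
      x ^ toℕ i                  ≈⟨ code-injective codeᵢ≡codeⱼ ⟩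
      x ^ toℕ j                  ≡⟨ ≡.cong (x ^_) i+1+p≡j ⟨
      x ^ suc (toℕ i ℕ.+ p)      ≡⟨ ≡.cong (x ^_) (ℕ.+-suc (toℕ i) p) ⟨
      x ^ (toℕ i ℕ.+ suc p)      ∎)

module MatrixRing {c ℓ : Level} (R : CommutativeRing c ℓ) where
  open import Data.Fin using (zero; suc)
  open CommutativeRing R hiding (zero)
  open Matrices R
  open import Algebra.Properties.CommutativeSemigroup +-commutativeSemigroup using (interchange)
  open import Relation.Binary.Reasoning.Setoid setoid

  Σᶠ-cong : ∀ n {f g : Fin n → Carrier} → (∀ i → f i ≈ g i) → Σᶠ n f ≈ Σᶠ n g
  Σᶠ-cong zero    f≈g = refl
  Σᶠ-cong (suc n) f≈g = +-cong (f≈g zero) (Σᶠ-cong n (f≈g ∘ suc))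

  Σᶠ-zero : ∀ n → Σᶠ n (λ _ → 0#) ≈ 0#
  Σᶠ-zero zero    = refl
  Σᶠ-zero (suc n) = trans (+-congˡ (Σᶠ-zero n)) (+-identityʳ 0#)

  Σᶠ-distrib-+ : ∀ n (f g : Fin n → Carrier) → Σᶠ n (λ i → f i + g i) ≈ Σᶠ n f + Σᶠ n g
  Σᶠ-distrib-+ zero    f g = sym (+-identityʳ 0#)
  Σᶠ-distrib-+ (suc n) f g = trans (+-congˡ (Σᶠ-distrib-+ n _ _)) (interchange _ _ _ _)

  Σᶠ-comm : ∀ m n (f : Fin m → Fin n → Carrier) →
            Σᶠ m (λ i → Σᶠ n (f i)) ≈ Σᶠ n (λ j → Σᶠ m (λ i → f i j))
  Σᶠ-comm zero    n f = sym (Σᶠ-zero n)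
  Σᶠ-comm (suc m) n f = trans (+-congˡ (Σᶠ-comm m n (f ∘ suc))) (sym (Σᶠ-distrib-+ n _ _))

  *-distribˡ-Σᶠ : ∀ n x (f : Fin n → Carrier) → x * Σᶠ n f ≈ Σᶠ n (λ i → x * f i)
  *-distribˡ-Σᶠ zero    x f = zeroʳ x
  *-distribˡ-Σᶠ (suc n) x f = trans (distribˡ x _ _) (+-congˡ (*-distribˡ-Σᶠ n x _))

  *-distribʳ-Σᶠ : ∀ n x (f : Fin n → Carrier) → Σᶠ n f * x ≈ Σᶠ n (λ i → f i * x)
  *-distribʳ-Σᶠ zero    x f = zeroˡ x
  *-distribʳ-Σᶠ (suc n) x f = trans (distribʳ x _ _) (+-congˡ (*-distribʳ-Σᶠ n x _))

  Σᶠ-I*ˡ : ∀ n (i : Fin n) (v : Fin n → Carrier) → Σᶠ n (λ l → I i l * v l) ≈ v i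
  Σᶠ-I*ˡ (suc n) zero v = begin
    1# * v zero + Σᶠ n (λ l → 0# * v (suc l))  ≈⟨ +-cong (*-identityˡ _) (Σᶠ-cong n (λ l → zeroˡ _)) ⟩
    v zero + Σᶠ n (λ _ → 0#)                   ≈⟨ +-congˡ (Σᶠ-zero n) ⟩
    v zero + 0#                                ≈⟨ +-identityʳ _ ⟩
    v zero                                     ∎
  Σᶠ-I*ˡ (suc n) (suc i) v = trans (+-cong (zeroˡ _) (Σᶠ-I*ˡ n i (v ∘ suc))) (+-identityˡ _)

  Σᶠ-*Iʳ : ∀ n (j : Fin n) (v : Fin n → Carrier) → Σᶠ n (λ l → v l * I l j) ≈ v j
  Σᶠ-*Iʳ (suc n) zero v = begin
    v zero * 1# + Σᶠ n (λ l → v (suc l) * 0#)  ≈⟨ +-cong (*-identityʳ _) (Σᶠ-cong n (λ l → zeroʳ _)) ⟩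
    v zero + Σᶠ n (λ _ → 0#)                   ≈⟨ +-congˡ (Σᶠ-zero n) ⟩
    v zero + 0#                                ≈⟨ +-identityʳ _ ⟩
    v zero                                     ∎
  Σᶠ-*Iʳ (suc n) (suc j) v = trans (+-cong (zeroʳ _) (Σᶠ-*Iʳ n j (v ∘ suc))) (+-identityˡ _)

  *ᴹ-assoc : ∀ {n} (A B C : Mat n) → ((A *ᴹ B) *ᴹ C) ≈ᴹ (A *ᴹ (B *ᴹ C))
  *ᴹ-assoc {n} A B C i j = begin
    Σᶠ n (λ l → Σᶠ n (λ m → A i m * B m l) * C l j)    ≈⟨ Σᶠ-cong n (λ l → *-distribʳ-Σᶠ n _ _) ⟩
    Σᶠ n (λ l → Σᶠ n (λ m → (A i m * B m l) * C l j))  ≈⟨ Σᶠ-comm n n _ ⟩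
    Σᶠ n (λ m → Σᶠ n (λ l → (A i m * B m l) * C l j))  ≈⟨ Σᶠ-cong n (λ m → Σᶠ-cong n (λ l → *-assoc _ _ _)) ⟩
    Σᶠ n (λ m → Σᶠ n (λ l → A i m * (B m l * C l j)))  ≈⟨ Σᶠ-cong n (λ m → *-distribˡ-Σᶠ n _ _) ⟨
    Σᶠ n (λ m → A i m * Σᶠ n (λ l → B m l * C l j))    ∎

  matrixRing : ℕ → Ring c ℓ
  matrixRing n = record
    { Carrier = Mat n
    ; _≈_ = _≈ᴹ_
    ; _+_ = λ A B i j → A i j + B i j
    ; _*_ = _*ᴹ_
    ; -_ = λ A i j → - A i j
    ; 0# = λ i j → 0#
    ; 1# = I
    ; isRing = record
      { +-isAbelianGroup = record
        { isGroup = record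
          { isMonoid = record
            { isSemigroup = record
              { isMagma = record
                { isEquivalence = record
                  { refl = λ i j → refl
                  ; sym = λ A≈B i j → sym (A≈B i j)
                  ; trans = λ A≈B B≈C i j → trans (A≈B i j) (B≈C i j) }
                ; ∙-cong = λ A≈B C≈D i j → +-cong (A≈B i j) (C≈D i j) }
              ; assoc = λ A B C i j → +-assoc _ _ _ }
            ; identity = (λ A i j → +-identityˡ _) , (λ A i j → +-identityʳ _) }
          ; inverse = (λ A i j → -‿inverseˡ _) , (λ A i j → -‿inverseʳ _)
          ; ⁻¹-cong = λ A≈B i j → -‿cong (A≈B i j) }
        ; comm = λ A B i j → +-comm _ _ }
      ; *-cong = λ A≈B C≈D i j → Σᶠ-cong n (λ l → *-cong (A≈B i l) (C≈D l j))
      ; *-assoc = *ᴹ-assoc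
      ; *-identity = (λ A i j → Σᶠ-I*ˡ n i (λ l → A l j)) , (λ A i j → Σᶠ-*Iʳ n j (A i))
      ; distrib = (λ A B C i j → trans (Σᶠ-cong n (λ l → distribˡ _ _ _)) (Σᶠ-distrib-+ n _ _))
                , (λ A B C i j → trans (Σᶠ-cong n (λ l → distribʳ _ _ _)) (Σᶠ-distrib-+ n _ _))
      }
    }

  module _ (n : ℕ) where
    private
      module Mₙ = Ring (matrixRing n)
      module Uₙ = ExponentOfUnits (matrixRing n)
      module U = ExponentOfUnits ring
    open import Algebra.Properties.Semiring.Exp Mₙ.semiring using (_^_)

    ^ᴹ≈^ : ∀ (A : Mat n) k → (A ^ᴹ k) ≈ᴹ (A ^ k)
    ^ᴹ≈^ A zero    = Mₙ.refl
    ^ᴹ≈^ A (suc k) = Mₙ.*-congˡ (^ᴹ≈^ A k)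

    killsGL⇔killsUnits : ∀ e → KillsGL n e ⇔ Uₙ.KillsUnits e
    killsGL⇔killsUnits e = mk⇔
      (λ kills g g-unit → Mₙ.trans (Mₙ.sym (^ᴹ≈^ g e)) (kills g g-unit))
      (λ kills g g-inv → Mₙ.trans (^ᴹ≈^ g e) (kills g g-inv))

    scalar : Carrier → Mat n
    scalar a i j = a * I i j

    scalar*ᴹ : ∀ a (A : Mat n) → (scalar a *ᴹ A) ≈ᴹ (λ i j → a * A i j)
    scalar*ᴹ a A i j = begin
      Σᶠ n (λ l → (a * I i l) * A l j)  ≈⟨ Σᶠ-cong n (λ l → *-assoc a _ _) ⟩
      Σᶠ n (λ l → a * (I i l * A l j))  ≈⟨ *-distribˡ-Σᶠ n a _ ⟨
      a * Σᶠ n (λ l → I i l * A l j)    ≈⟨ *-congˡ (Σᶠ-I*ˡ n i (λ l → A l j)) ⟩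
      a * A i j                         ∎

    ιᴹ≈scalar∘ι : ∀ a → Uₙ.ι a ≈ᴹ scalar (U.ι a)
    ιᴹ≈scalar∘ι zero    i j = sym (zeroˡ _)
    ιᴹ≈scalar∘ι (suc a) i j = trans (+-cong (sym (*-identityˡ _)) (ιᴹ≈scalar∘ι a i j)) (sym (distribʳ _ _ _))

    natImageZeroOrInvertible : U.NatImageZeroOrInvertible → Uₙ.NatImageZeroOrInvertible
    natImageZeroOrInvertible dichotomy a with dichotomy a
    ... | inj₁ ιa≈0 = inj₁ (λ i j → trans (ιᴹ≈scalar∘ι a i j) (trans (*-congʳ ιa≈0) (zeroˡ _)))
    ... | inj₂ (u , ιa*u≈1) = inj₂ (scalar u , λ i j → begin
      (Uₙ.ι a *ᴹ scalar u) i j         ≈⟨ Mₙ.*-congʳ {scalar u} (ιᴹ≈scalar∘ι a) i j ⟩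
      (scalar (U.ι a) *ᴹ scalar u) i j ≈⟨ scalar*ᴹ (U.ι a) (scalar u) i j ⟩
      U.ι a * (u * I i j)              ≈⟨ *-assoc _ u _ ⟨
      (U.ι a * u) * I i j              ≈⟨ *-congʳ ιa*u≈1 ⟩
      1# * I i j                       ≈⟨ *-identityˡ _ ⟩
      I i j                            ∎)

module FiniteFieldMatrices {c ℓ : Level} {q : ℕ} (F : FiniteField c ℓ q) (n : ℕ) where
  open FiniteField F
  open CommutativeRing ring using (_≈_; 0#; setoid)
  open IsFieldRing isField
  open Matrices ring
  open MatrixRing ring
  open ExponentOfUnits (matrixRing n)
  private
    module Mₙ = Ring (matrixRing n)
    module U = ExponentOfUnits (CommutativeRing.ring ring)
  open import Algebra.Properties.Semiring.Exp Mₙ.semiring using (_^_)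

  code : Injection setoid (≡.setoid (Fin q))
  code = Inverse⇒Injection (Symmetry.inverse (Bijection⇒Inverse counting))

  field-zeroOrInvertible : ∀ x → x ≈ 0# ⊎ U.RightInvertible x
  field-zeroOrInvertible x with via-injection code Fin._≟_ x 0#
  ... | yes x≈0 = inj₁ x≈0
  ... | no  x≉0 = inj₂ (inverse x x≉0)

  matrixCode : Mat n → Fin ((q ℕ.^ n) ℕ.^ n)
  matrixCode A = funToFin (λ i → funToFin (λ j → Injection.to code (A i j)))

  matrixCode-injective : ∀ {A B} → matrixCode A ≡ matrixCode B → A ≈ᴹ B
  matrixCode-injective codeA≡codeB i j =
    Injection.injective code (funToFin-injective (funToFin-injective codeA≡codeB i) j)
    where
    funToFin-injective : ∀ {m k} {f g : Fin m → Fin k} → funToFin f ≡ funToFin g → ∀ i → f i ≡ g i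
    funToFin-injective {f = f} {g} f≡g i =
      ≡.trans (≡.sym (finToFun-funToFin f i))
              (≡.trans (≡.cong (λ x → Fin.finToFun x i) f≡g) (finToFun-funToFin g i))

  idempotent⇒^ᴹ≈ : ∀ {A} → (A *ᴹ A) ≈ᴹ A → ∀ k → (A ^ᴹ suc k) ≈ᴹ A
  idempotent⇒^ᴹ≈ {A} Aᵢ k = Mₙ.trans (^ᴹ≈^ n A (suc k)) (idempotent-^ Aᵢ k)

  ^ᴹ-idempotent⇔ : ∀ A k → ((A ^ᴹ k) *ᴹ (A ^ᴹ k)) ≈ᴹ (A ^ᴹ k) ⇔ IsIdempotent (A ^ k)
  ^ᴹ-idempotent⇔ A k = mk⇔
    (λ Aᵏᵢ → Mₙ.trans (Mₙ.*-cong (Mₙ.sym Aᵏ≈) (Mₙ.sym Aᵏ≈)) (Mₙ.trans Aᵏᵢ Aᵏ≈))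
    (λ Aᵏᵢ → Mₙ.trans (Mₙ.*-cong Aᵏ≈ Aᵏ≈) (Mₙ.trans Aᵏᵢ (Mₙ.sym Aᵏ≈)))
    where Aᵏ≈ = ^ᴹ≈^ n A k

  private
    fromKillsGL : ∀ e → KillsGL n e → KillsUnits e
    fromKillsGL e = Equivalence.to (killsGL⇔killsUnits n e)
    toKillsGL : ∀ e → KillsUnits e → KillsGL n e
    toKillsGL e = Equivalence.from (killsGL⇔killsUnits n e)

  killsGL-* : ∀ {e} → KillsGL n e → ∀ d → KillsGL n (d ℕ.* e)
  killsGL-* {e} kills d = toKillsGL (d ℕ.* e) (killsUnits-* (fromKillsGL e kills) d)

  exponentGL-∣ : ∀ {e k} → IsExponentGL n e → KillsGL n k → e ∣ k
  exponentGL-∣ {e} {k} isExponent killsₖ =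
    leastKiller-∣ (λ d 0<d → least d 0<d ∘ toKillsGL d) (fromKillsGL e kills) (fromKillsGL k killsₖ)
    where
    open IsExponentGL isExponent
    instance _ = ℕ.>-nonZero positive

  powersIdempotent⇒killsGL : ∀ k → (∀ B → ((B ^ᴹ k) *ᴹ (B ^ᴹ k)) ≈ᴹ (B ^ᴹ k)) → KillsGL n k
  powersIdempotent⇒killsGL k powersIdempotent =
    toKillsGL k (idempotentPowers⇒killsUnits k λ B →
      Equivalence.to (^ᴹ-idempotent⇔ B k) (powersIdempotent B))

  killsGL⇒powersIdempotent : ∀ k → KillsGL n (suc k) →
                             ∀ B → ((B ^ᴹ suc k) *ᴹ (B ^ᴹ suc k)) ≈ᴹ (B ^ᴹ suc k)
  killsGL⇒powersIdempotent k kills B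
    with m , Eᵢ ← finite⇒idempotentPower matrixCode matrixCode-injective B =
    Equivalence.from (^ᴹ-idempotent⇔ B (suc k))
      (killsUnits⇒idempotentPowers dichotomy k (fromKillsGL (suc k) kills) B m Eᵢ)
    where
    dichotomy : NatImageZeroOrInvertible
    dichotomy = natImageZeroOrInvertible n (field-zeroOrInvertible ∘ U.ι)

proposition2p3 : ∀ {c ℓ : Level} (q : ℕ) → IsPrimePower q → (F : FiniteField c ℓ q) → (n k e : ℕ) → 2 ≤ n → 1 ≤ k → Matrices.IsExponentGL (FiniteField.ring F) n e → Matrices.IdempotentsAreKthPowers (FiniteField.ring F) n k ⇔ e ∣ k
proposition2p3 q _ F n (suc k) e _ _ isExponent = mk⇔ necessity sufficiency
  where
  open Matrices (FiniteField.ring F)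
  open FiniteFieldMatrices F n
  necessity : IdempotentsAreKthPowers n (suc k) → e ∣ suc k
  necessity (_ , powersIdempotent) =
    exponentGL-∣ isExponent (powersIdempotent⇒killsGL (suc k) powersIdempotent)
  sufficiency : e ∣ suc k → IdempotentsAreKthPowers n (suc k)
  sufficiency (divides d k≡de) =
    (λ A Aᵢ → A , idempotent⇒^ᴹ≈ Aᵢ k) , killsGL⇒powersIdempotent k killsₖ
    where
    killsₖ : KillsGL n (suc k)
    killsₖ = ≡.subst (KillsGL n) (≡.sym k≡de) (killsGL-* (IsExponentGL.kills isExponent) d)
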